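{- For every type $\sigma$: (1) $[\![\sigma]\!]\subseteq\mathrm{SN}$; (2) for every variable $x$ and every finite sequence $u_1,\dots,u_n$ ($n\ge0$) of terms in $\mathrm{SN}$, we have $x\,u_1\cdots u_n\in[\![\sigma]\!]$.
   Context: Calculus $\lambda^{::}_{\mathtt{catch}}$. Types: $\sigma,\tau,\rho ::= \mathtt{unit} \mid \mathtt{list}\,\tau \mid \sigma\to\tau$. Terms: $t,r,s ::= x \mid () \mid \mathtt{nil} \mid (::) \mid \mathtt{lrec} \mid \lambda x.r \mid t\,s \mid \mathtt{catch}\,\alpha\,t \mid \mathtt{throw}\,\alpha\,t$ ($x$ variables, $\alpha,\beta$ continuation variables; application left-associative; $t::r$ abbreviates $(::)\,t\,r$). $\mathrm{FCV}$ = free continuation variables, $t[x:=r]$ capture-avoiding substitution. Values: $v,w ::= x \mid () \mid \mathtt{nil} \mid (::) \mid (::)\,v \mid (::)\,v\,w \mid \mathtt{lrec} \mid \mathtt{lrec}\,v \mid \mathtt{lrec}\,v\,w \mid \lambda x.r$. Contexts $E ::= \Box\,t \mid v\,\Box \mid \mathtt{throw}\,\alpha\,\Box$. Reduction $\to$ is the compatible closure of: $(\lambda x.t)\,v\to t[x:=v]$; $E[\mathtt{throw}\,\alpha\,t]\to\mathtt{throw}\,\alpha\,t$; $\mathtt{catch}\,\alpha\,(\mathtt{throw}\,\alpha\,t)\to\mathtt{catch}\,\alpha\,t$; $\mathtt{catch}\,\alpha\,(\mathtt{throw}\,\beta\,v)\to\mathtt{throw}\,\beta\,v$ if $\alpha\notin\{\beta\}\cup\mathrm{FCV}(v)$;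 $\mathtt{catch}\,\alpha\,v\to v$ if $\alpha\notin\mathrm{FCV}(v)$; $\mathtt{lrec}\,v_r\,v_s\,\mathtt{nil}\to v_r$; $\mathtt{lrec}\,v_r\,v_s\,(v_h::v_t)\to v_s\,v_h\,v_t\,(\mathtt{lrec}\,v_r\,v_s\,v_t)$; $\twoheadrightarrow$ is its reflexive-transitive closure. $\mathrm{SN}$ is the set of terms $t$ for which the lengths of all reduction sequences starting at $t$ are bounded. For a set of terms $S$, $L(S)$ is inductively defined by: $t\in L(S)$ if for all values $v,w$ with $t\twoheadrightarrow v::w$ we have $v\in S$ and $w\in L(S)$. Interpretation: $[\![\mathtt{unit}]\!]=\mathrm{SN}$, $[\![\mathtt{list}\,\sigma]\!]=\mathrm{SN}\cap L([\![\sigma]\!])$, $[\![\sigma\to\tau]\!]=\{t\mid \forall s\in[\![\sigma]\!],\ ts\in[\![\tau]\!]\}$. -}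

module Defs where

open import Data.Nat using (ℕ; zero; suc; pred; _≤_)
open import Data.Bool using (Bool; true; false; _∨_; if_then_else_)
open import Data.Nat using (_≡ᵇ_)
open import Data.Product using (Σ; _×_; _,_)
open import Data.List using (List; foldl)
open import Relation.Binary.PropositionalEquality using (_≡_)
open import Relation.Nullary using (¬_)
open import Relation.Binary.Construct.Closure.ReflexiveTransitive using (Star)

infixr 30 _⇒_
data Ty : Set where
  unit : Ty
  list : Ty → Ty
  _⇒_  : Ty → Ty → Ty

-- Terms, in de Bruijn notation for both term variables (bound by λ)
-- and continuation variables (bound by catch).

data Tm : Set where
  var   : ℕ → Tm
  ⟨⟩    : Tm
  nil   : Tm
  cons  : Tm
  lrec  : Tm
  lam   : Tm → Tm
  app   : Tm → Tm → Tm
  catch : Tm → Tm           -- catch α t  (binds continuation index 0)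
  throw : ℕ → Tm → Tm

_∷ₜ_ : Tm → Tm → Tm
t ∷ₜ r = app (app cons t) r

liftR : (ℕ → ℕ) → ℕ → ℕ
liftR ρ zero    = zero
liftR ρ (suc n) = suc (ρ n)

ren : (ℕ → ℕ) → (ℕ → ℕ) → Tm → Tm
ren ρ κ (var x)     = var (ρ x)
ren ρ κ ⟨⟩          = ⟨⟩
ren ρ κ nil         = nil
ren ρ κ cons        = cons
ren ρ κ lrec        = lrec
ren ρ κ (lam t)     = lam (ren (liftR ρ) κ t)
ren ρ κ (app t s)   = app (ren ρ κ t) (ren ρ κ s)
ren ρ κ (catch t)   = catch (ren ρ (liftR κ) t)
ren ρ κ (throw α t) = throw (κ α) (ren ρ κ t)

extsT : (ℕ → Tm) → ℕ → Tm
extsT σ zero    = var zero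
extsT σ (suc n) = ren suc (λ k → k) (σ n)

extsC : (ℕ → Tm) → ℕ → Tm
extsC σ n = ren (λ k → k) suc (σ n)

sub : (ℕ → Tm) → Tm → Tm
sub σ (var x)     = σ x
sub σ ⟨⟩          = ⟨⟩
sub σ nil         = nil
sub σ cons        = cons
sub σ lrec        = lrec
sub σ (lam t)     = lam (sub (extsT σ) t)
sub σ (app t s)   = app (sub σ t) (sub σ s)
sub σ (catch t)   = catch (sub (extsC σ) t)
sub σ (throw α t) = throw α (sub σ t)

single : Tm → ℕ → Tm
single v zero    = v
single v (suc n) = var n

_[0:=_] : Tm → Tm → Tm
t [0:= v ] = sub (single v) t

data _∈FCV_ : ℕ → Tm → Set where
  lam∈    : ∀ {α t}   → α ∈FCV t → α ∈FCV lam t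
  appˡ∈   : ∀ {α t s} → α ∈FCV t → α ∈FCV app t s
  appʳ∈   : ∀ {α t s} → α ∈FCV s → α ∈FCV app t s
  catch∈  : ∀ {α t}   → suc α ∈FCV t → α ∈FCV catch t
  throw₀∈ : ∀ {α t}   → α ∈FCV throw α t
  throw∈  : ∀ {α β t} → α ∈FCV t → α ∈FCV throw β t

-- Removing the (non-occurring) continuation binder 0
lowerC : Tm → Tm
lowerC = ren (λ k → k) pred

data Value : Tm → Set where
  var   : ∀ x → Value (var x)
  ⟨⟩    : Value ⟨⟩
  nil   : Value nil
  cons  : Value cons
  cons1 : ∀ {v}   → Value v → Value (app cons v)
  cons2 : ∀ {v w} → Value v → Value w → Value (app (app cons v) w)
  lrec  : Value lrec
  lrec1 : ∀ {v}   → Value v → Value (app lrec v)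
  lrec2 : ∀ {v w} → Value v → Value w → Value (app (app lrec v) w)
  lam   : ∀ t → Value (lam t)

infix 4 _⟶_
data _⟶_ : Tm → Tm → Set where
  β      : ∀ {t v} → Value v → app (lam t) v ⟶ t [0:= v ]
  -- E[throw α t] → throw α t,  E ::= □ t | v □ | throw α □
  thrAppˡ : ∀ {α t s} → app (throw α t) s ⟶ throw α t
  thrAppʳ : ∀ {v α t} → Value v → app v (throw α t) ⟶ throw α t
  thrThr  : ∀ {β α t} → throw β (throw α t) ⟶ throw α t
  catchThrow  : ∀ {t} → catch (throw zero t) ⟶ catch t
  -- catch α (throw β v) → throw β v   if α ∉ {β} ∪ FCV(v)
  catchThrowβ : ∀ {β v} → Value v → ¬ (zero ∈FCV v) →
                catch (throw (suc β) v) ⟶ throw β (lowerC v)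
  catchVal : ∀ {v} → Value v → ¬ (zero ∈FCV v) → catch v ⟶ lowerC v
  lrecNil  : ∀ {vr vs} → Value vr → Value vs →
             app (app (app lrec vr) vs) nil ⟶ vr
  lrecCons : ∀ {vr vs vh vt} → Value vr → Value vs → Value vh → Value vt →
             app (app (app lrec vr) vs) (vh ∷ₜ vt) ⟶
             app (app (app vs vh) vt) (app (app (app lrec vr) vs) vt)
  ξlam   : ∀ {t t'} → t ⟶ t' → lam t ⟶ lam t'
  ξappˡ  : ∀ {t t' s} → t ⟶ t' → app t s ⟶ app t' s
  ξappʳ  : ∀ {t s s'} → s ⟶ s' → app t s ⟶ app t s'
  ξcatch : ∀ {t t'} → t ⟶ t' → catch t ⟶ catch t'
  ξthrow : ∀ {α t t'} → t ⟶ t' → throw α t ⟶ throw α t'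

infix 4 _↠_
_↠_ : Tm → Tm → Set
_↠_ = Star _⟶_

data _⟶[_]_ : Tm → ℕ → Tm → Set where
  done : ∀ {t} → t ⟶[ zero ] t
  step : ∀ {t t' t'' n} → t ⟶ t' → t' ⟶[ n ] t'' → t ⟶[ suc n ] t''

SN : Tm → Set
SN t = Σ ℕ λ b → ∀ k t' → t ⟶[ k ] t' → k ≤ b

data L (S : Tm → Set) : Tm → Set where
  mkL : ∀ {t} →
        (∀ v w → Value v → Value w → t ↠ (v ∷ₜ w) → S v × L S w) →
        L S t

⟦_⟧ : Ty → Tm → Set
⟦ unit ⟧   t = SN t
⟦ list σ ⟧ t = SN t × L ⟦ σ ⟧ t
⟦ σ ⇒ τ ⟧  t = ∀ s → ⟦ σ ⟧ s → ⟦ τ ⟧ (app t s)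

apps : Tm → List Tm → Tm
apps = foldl app

module Submission where

open import Defs
open import Data.Nat using (ℕ; zero; suc; _+_; _<_; _≤_; z≤n; s≤s; s≤s⁻¹)
open import Data.Nat.Properties using (≤-refl; ≤-trans; m≤m+n; m≤n+m; n<1+n; +-monoˡ-<; +-monoʳ-<)
open import Data.List using (List; []; _∷ʳ_; foldl)
open import Data.List.Properties using (foldl-∷ʳ)
open import Data.List.Relation.Unary.All using (All; []; _∷_)
open import Data.List.Relation.Unary.All.Properties using (∷ʳ⁺)
open import Data.Product using (_×_; _,_; proj₁; proj₂; ∃-syntax)
open import Data.Empty using (⊥-elim)
open import Relation.Nullary using (¬_)
open import Relation.Binary.PropositionalEquality using (_≡_; refl; subst)
open import Relation.Binary.Construct.Closure.ReflexiveTransitive using (ε; _◅_)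

-- A variable applied to strongly normalising arguments (or a term that
-- has collapsed into a throw) has no β- or lrec-redex at its head: it
-- can only reduce inside an argument or by propagating a throw. Both
-- decrease the measure indexing Neutral, which therefore bounds every
-- reduction sequence; and no reduct is ever a cons cell, so L holds
-- vacuously. The arrow case then follows by applying to a variable.

SN≤ : ℕ → Tm → Set
SN≤ n t = ∀ k t' → t ⟶[ k ] t' → k ≤ n

SN≤-step : ∀ {n t t'} → SN≤ n t → t ⟶ t' → ∃[ n' ] n ≡ suc n' × SN≤ n' t'
SN≤-step {zero}  h r with h 1 _ (step r done)
... | ()
SN≤-step {suc n} h r = n , refl , λ k t'' rs → s≤s⁻¹ (h (suc k) t'' (step r rs))

appˡ-steps : ∀ {t t' s k} → t ⟶[ k ] t' → app t s ⟶[ k ] app t' s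
appˡ-steps done        = done
appˡ-steps (step r rs) = step (ξappˡ r) (appˡ-steps rs)

SN-appˡ : ∀ {t s} → SN (app t s) → SN t
SN-appˡ (b , h) = b , λ k t' rs → h k _ (appˡ-steps rs)

data Neutral : ℕ → Tm → Set where
  var   : ∀ {x} → Neutral 0 (var x)
  app   : ∀ {m b t u} → Neutral m t → SN≤ b u → Neutral (suc (m + b)) (app t u)
  throw : ∀ {n α s} → SN≤ n (throw α s) → Neutral n (throw α s)

Neutral-step : ∀ {n t t'} → Neutral n t → t ⟶ t' → ∃[ n' ] n' < n × Neutral n' t'
Neutral-step (app () _) (β _)
Neutral-step (app (app (app () _) _) _) (lrecNil _ _)
Neutral-step (app (app (app () _) _) _) (lrecCons _ _ _ _)
Neutral-step (app {m} {b} (throw ht) _) thrAppˡ = m , s≤s (m≤m+n m b) , throw ht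
Neutral-step (app {m} {b} _ hu) (thrAppʳ _)     = b , s≤s (m≤n+m b m) , throw hu
Neutral-step (app {b = b} nt hu) (ξappˡ r) with Neutral-step nt r
... | m' , m'<m , nt' = suc (m' + b) , s≤s (+-monoˡ-< b m'<m) , app nt' hu
Neutral-step (app {m} nt hu) (ξappʳ r) with SN≤-step hu r
... | b' , refl , hu' = suc (m + b') , s≤s (+-monoʳ-< m (n<1+n b')) , app nt hu'
Neutral-step (throw ht) thrThr with SN≤-step ht thrThr
... | n' , refl , ht' = n' , ≤-refl , throw ht'
Neutral-step (throw ht) (ξthrow r) with SN≤-step ht (ξthrow r)
... | n' , refl , ht' = n' , ≤-refl , throw ht'

Neutral⇒SN≤ : ∀ {n t} → Neutral n t → SN≤ n t
Neutral⇒SN≤ nt _ _ done = z≤n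
Neutral⇒SN≤ nt _ _ (step r rs) with Neutral-step nt r
... | n' , n'<n , nt' = ≤-trans (s≤s (Neutral⇒SN≤ nt' _ _ rs)) n'<n

Neutral-↠ : ∀ {n t t'} → Neutral n t → t ↠ t' → ∃[ n' ] Neutral n' t'
Neutral-↠ nt ε        = _ , nt
Neutral-↠ nt (r ◅ rs) with Neutral-step nt r
... | _ , _ , nt' = Neutral-↠ nt' rs

¬Neutral-∷ : ∀ {n v w} → ¬ Neutral n (v ∷ₜ w)
¬Neutral-∷ (app (app () _) _)

Neutral⇒L : ∀ {S n t} → Neutral n t → L S t
Neutral⇒L nt = mkL λ _ _ _ _ rs → ⊥-elim (¬Neutral-∷ (proj₂ (Neutral-↠ nt rs)))

Neutral-apps : ∀ {m t us} → Neutral m t → All SN us → ∃[ n ] Neutral n (foldl app t us)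
Neutral-apps nt []               = _ , nt
Neutral-apps nt ((_ , hu) ∷ hus) = Neutral-apps (app nt hu) hus

SN-var-apps : ∀ x us → All SN us → SN (apps (var x) us)
SN-var-apps x us hus with Neutral-apps {us = us} (var {x}) hus
... | n , nt = n , Neutral⇒SN≤ nt

L-var-apps : ∀ {S} x us → All SN us → L S (apps (var x) us)
L-var-apps x us hus = Neutral⇒L (proj₂ (Neutral-apps {us = us} (var {x}) hus))

lemma4p8 : ∀ (σ : Ty) →
    (∀ t → ⟦ σ ⟧ t → SN t) ×
    (∀ (x : ℕ) (us : List Tm) → All SN us → ⟦ σ ⟧ (apps (var x) us))
lemma4p8 unit     = (λ _ sn → sn) , SN-var-apps
lemma4p8 (list σ) = (λ _ → proj₁) , λ x us hus → SN-var-apps x us hus , L-var-apps x us hus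
lemma4p8 (σ ⇒ τ) with lemma4p8 σ | lemma4p8 τ
... | ⟦σ⟧⊆SN , var-apps∈⟦σ⟧ | ⟦τ⟧⊆SN , var-apps∈⟦τ⟧ = ⟦σ⇒τ⟧⊆SN , var-apps∈⟦σ⇒τ⟧
  where
  ⟦σ⇒τ⟧⊆SN : ∀ t → ⟦ σ ⇒ τ ⟧ t → SN t
  ⟦σ⇒τ⟧⊆SN t ht = SN-appˡ (⟦τ⟧⊆SN _ (ht (var 0) (var-apps∈⟦σ⟧ 0 [] [])))

  var-apps∈⟦σ⇒τ⟧ : ∀ x us → All SN us → ⟦ σ ⇒ τ ⟧ (apps (var x) us)
  var-apps∈⟦σ⇒τ⟧ x us hus s hs =
    subst ⟦ τ ⟧ (foldl-∷ʳ app (var x) s us)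
          (var-apps∈⟦τ⟧ x (us ∷ʳ s) (∷ʳ⁺ hus (⟦σ⟧⊆SN s hs)))
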